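{- Let $\mathcal{S}$ be an SE system and let $Q$ be a finite sequence of Boolean operators. Then $Q$ commutes on $\mathcal{S}$.
   Context: A system is $\mathcal{S}=(S,\{0,1\}^X)$ with $X$ finite and $S\subseteq\{0,1\}^X$, $\dim(\mathcal{S})=X$. For disjoint $A,B$, $f\in\{0,1\}^A,g\in\{0,1\}^B$, $g\star f$ is the common extension. $\mathcal{S}$ shatters $Y\subseteq X$ if $\forall f\in\{0,1\}^Y\ \exists g\in\{0,1\}^{X\setminus Y}: g\star f\in S$; strongly shatters $Y$ if $\exists g\ \forall f$; $\mathcal{S}$ is SE if these two families of subsets coincide. Boolean operators are the operators $\mathrm{Int}_Y$ and $\mathrm{Un}_Y$ ($Y$ any finite set), defined only on systems with $Y\subseteq\dim(\mathcal{S})$ by $\mathrm{Int}_Y(\mathcal{S})=(\{g\in\{0,1\}^{X\setminus Y}:\forall f\in\{0,1\}^Y, g\star f\in S\},\{0,1\}^{X\setminus Y})$ and $\mathrm{Un}_Y(\mathcal{S})=(\{g\in\{0,1\}^{X\setminus Y}:\exists f\in\{0,1\}^Y, g\star f\in S\},\{0,1\}^{X\setminus Y})$. Compositions of these partial operators are always considered (possibly undefined), and an equation $e_1=e_2$ is true iff both sides are undefined or both are defined and equal. $Q(\mathcal{S})$ is the result of applying the operators of $Q$ one after the other; $Q$ commutes on $\mathcal{S}$ if $Q'(\mathcal{S})=Q(\mathcal{S})$ for every permutation $Q'$ of $Q$. -}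

module Defs where

open import Data.Nat using (ℕ)
open import Data.Fin using (Fin)
open import Data.Bool using (Bool; if_then_else_)
open import Data.Vec using (lookup)
open import Data.Fin.Subset using (Subset; _⊆_; _─_; _∈_)
open import Data.Fin.Subset.Properties using (_⊆?_)
open import Data.Product using (Σ; _×_; ∃)
open import Data.Maybe using (Maybe; just; nothing; _>>=_)
open import Data.List using (List; []; _∷_)
open import Data.Empty.Polymorphic using (⊥)
open import Data.Unit.Polymorphic using (⊤)
open import Relation.Nullary using (Dec; yes; no)
open import Relation.Binary.PropositionalEquality using (_≡_)
open import Function.Bundles using (_⇔_)

-- A total assignment is a function Fin n → Bool;
-- an element of {0,1}^X is represented by any total assignment, only its
-- values on X being relevant (see WellFormed).

Assignment : ℕ → Set
Assignment n = Fin n → Bool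

-- A system (S, {0,1}^X): dimension X and the membership predicate of S.
record System (n : ℕ) : Set₁ where
  constructor mkSystem
  field
    dim : Subset n
    mem : Assignment n → Set
open System public

-- S ⊆ {0,1}^X : membership depends only on the coordinates in X.
WellFormed : ∀ {n} → System n → Set
WellFormed {n} 𝒮 = ∀ (g h : Assignment n) →
  (∀ i → i ∈ dim 𝒮 → g i ≡ h i) → mem 𝒮 g → mem 𝒮 h

-- S is a finite set: membership is decidable.
DecidableSystem : ∀ {n} → System n → Set
DecidableSystem {n} 𝒮 = ∀ (g : Assignment n) → Dec (mem 𝒮 g)

_⋆[_]_ : ∀ {n} → Assignment n → Subset n → Assignment n → Assignment n
(g ⋆[ Y ] f) i = if lookup Y i then f i else g i

Shatters : ∀ {n} → System n → Subset n → Set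
Shatters {n} 𝒮 Y = ∀ (f : Assignment n) → ∃ λ (g : Assignment n) → mem 𝒮 (g ⋆[ Y ] f)

StronglyShatters : ∀ {n} → System n → Subset n → Set
StronglyShatters {n} 𝒮 Y = ∃ λ (g : Assignment n) → ∀ (f : Assignment n) → mem 𝒮 (g ⋆[ Y ] f)

SE : ∀ {n} → System n → Set
SE 𝒮 = ∀ Y → Y ⊆ dim 𝒮 → (Shatters 𝒮 Y ⇔ StronglyShatters 𝒮 Y)

data BoolOp (n : ℕ) : Set where
  Int : Subset n → BoolOp n
  Un  : Subset n → BoolOp n

applyOp : ∀ {n} → BoolOp n → System n → Maybe (System n)
applyOp {n} (Int Y) 𝒮 with Y ⊆? dim 𝒮
... | yes _ = just (mkSystem (dim 𝒮 ─ Y) (λ g → ∀ (f : Assignment n) → mem 𝒮 (g ⋆[ Y ] f)))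
... | no  _ = nothing
applyOp {n} (Un Y) 𝒮 with Y ⊆? dim 𝒮
... | yes _ = just (mkSystem (dim 𝒮 ─ Y) (λ g → ∃ λ (f : Assignment n) → mem 𝒮 (g ⋆[ Y ] f)))
... | no  _ = nothing

applySeq : ∀ {n} → List (BoolOp n) → System n → Maybe (System n)
applySeq []      𝒮 = just 𝒮
applySeq (o ∷ Q) 𝒮 = applyOp o 𝒮 >>= applySeq Q

_≈S_ : ∀ {n} → System n → System n → Set
𝒮 ≈S 𝒯 = (dim 𝒮 ≡ dim 𝒯) × (∀ g → mem 𝒮 g ⇔ mem 𝒯 g)

_≈M_ : ∀ {n} → Maybe (System n) → Maybe (System n) → Set₁
nothing ≈M nothing = ⊤
just 𝒮  ≈M just 𝒯  = 𝒮 ≈S 𝒯 × ⊤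
nothing ≈M just _  = ⊥
just _  ≈M nothing = ⊥

-- Two operators with disjoint supports commute on an SE system.  For Int–Int and
-- Un–Un this is just a reordering of quantifiers, and ∃e∀f ⇒ ∀f∃e is trivial; the
-- converse ∀f∃e ⇒ ∃e∀f says that Y is strongly shattered by the restriction of S that
-- fixes every coordinate outside Y ∪ Z, which follows from plain shattering because
-- restrictions of SE systems are SE (fix one coordinate at a time).  Since Int_Y and
-- Un_Y preserve SE, every intermediate system is SE, and a permutation of Q is a
-- sequence of adjacent transpositions, each of which preserves definedness.

module Submission where

open import Defs
open import Data.Nat using (ℕ)
open import Data.Bool using (true; false; not; _∨_) renaming (_≟_ to _≟B_)
open import Data.Bool.Properties using (¬-not)
open import Data.Fin using (Fin; _≟_)
open import Data.Fin.Subset using (Subset; _⊆_; _⊂_; _─_; _-_; _∈_; _∉_; _∪_; _∩_; ∁; ⁅_⁆; ⊥; Empty)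
open import Data.Fin.Subset.Properties
  using ( _⊆?_; _∈?_; nonempty?; Empty-unique; ⊆-antisym; ∉⊥; x∈⁅x⁆; x∈⁅y⁆⇒x≡y; x≢y⇒x∉⁅y⁆
        ; x∈p∩q⁺; x∈p∩q⁻; ∩-comm; x∈p∪q⁺; x∈p∪q⁻; p─⊥≡p; p─q⊆p; p─q─r≡p─q∪r; p─q─r≡p─r─q
        ; x∈p∧x∉q⇒x∈p─q; x∈p∧x≢y⇒x∈p-y; x∈p⇒p-x⊂p; x∈p⇒x∉∁p )
open import Data.Fin.Subset.Induction using (Acc; acc; ⊂-wellFounded)
open import Data.Vec using (_∷_; lookup; there)
open import Data.Vec.Properties using ([]=⇒lookup; lookup⇒[]=; lookup-zipWith; lookup-map)
open import Data.Product using (∃; _×_; _,_; map₂)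
open import Data.Sum using (inj₁; inj₂)
open import Data.Maybe using (Maybe; just; nothing)
open import Data.List using (List; []; _∷_)
open import Data.List.Relation.Binary.Permutation.Propositional using (_↭_; refl; prep; swap; trans)
open import Data.Unit.Polymorphic using (tt)
open import Data.Empty using (⊥-elim)
open import Function using (_∘_)
open import Function.Bundles using (_⇔_; mk⇔; Equivalence)
import Function.Properties.Equivalence as ⇔
open import Relation.Nullary using (¬_; Dec; yes; no; contradiction; _×-dec_)
open import Relation.Binary.PropositionalEquality as ≡ using (_≡_; _≢_; _≗_; refl; subst; subst₂)

private
  variable
    n : ℕ

x∈p─q⇒x∉q : ∀ {x : Fin n} (p q : Subset n) → x ∈ p ─ q → x ∉ q
x∈p─q⇒x∉q (_ ∷ p) (_ ∷ q) (there x∈p─q) (there x∈q) = x∈p─q⇒x∉q p q x∈p─q x∈q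

⊆─⇒disjoint : ∀ {D Y Z : Subset n} → Z ⊆ D ─ Y → Empty (Y ∩ Z)
⊆─⇒disjoint {D = D} {Y} {Z} Z⊆D─Y (i , i∈Y∩Z) =
  let i∈Y , i∈Z = x∈p∩q⁻ Y Z i∈Y∩Z in x∈p─q⇒x∉q D Y (Z⊆D─Y i∈Z) i∈Y

⁅x⁆∪p-x≡p : ∀ {x : Fin n} {p : Subset n} → x ∈ p → ⁅ x ⁆ ∪ (p - x) ≡ p
⁅x⁆∪p-x≡p {x = x} {p} x∈p = ⊆-antisym ⊆p p⊆
  where
    ⊆p : ⁅ x ⁆ ∪ (p - x) ⊆ p
    ⊆p i∈ with x∈p∪q⁻ ⁅ x ⁆ (p - x) i∈
    ... | inj₁ i∈⁅x⁆ rewrite x∈⁅y⁆⇒x≡y x i∈⁅x⁆ = x∈p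
    ... | inj₂ i∈p-x = p─q⊆p p ⁅ x ⁆ i∈p-x
    p⊆ : p ⊆ ⁅ x ⁆ ∪ (p - x)
    p⊆ {i} i∈p with i ≟ x
    ... | yes refl = x∈p∪q⁺ (inj₁ (x∈⁅x⁆ x))
    ... | no  i≢x  = x∈p∪q⁺ (inj₂ (x∈p∧x≢y⇒x∈p-y i∈p i≢x))

⋆-∈ : ∀ {Y : Subset n} {i} (g f : Assignment n) → i ∈ Y → (g ⋆[ Y ] f) i ≡ f i
⋆-∈ g f i∈Y rewrite []=⇒lookup i∈Y = refl

⋆-∉ : ∀ {Y : Subset n} {i} (g f : Assignment n) → i ∉ Y → (g ⋆[ Y ] f) i ≡ g i
⋆-∉ {Y = Y} {i} g f i∉Y with lookup Y i in eq
... | true  = contradiction (lookup⇒[]= i Y eq) i∉Y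
... | false = refl

⋆-idem : ∀ (Y : Subset n) g → g ⋆[ Y ] g ≗ g
⋆-idem Y g i with lookup Y i
... | true  = refl
... | false = refl

⋆-congʳ : ∀ (Y : Subset n) g {f f′} → f ≗ f′ → g ⋆[ Y ] f ≗ g ⋆[ Y ] f′
⋆-congʳ Y g f≗f′ i with lookup Y i
... | true  = f≗f′ i
... | false = refl

⋆-⋆-∪ : ∀ (W Y : Subset n) g f e → (g ⋆[ W ] f) ⋆[ Y ] e ≗ g ⋆[ W ∪ Y ] (f ⋆[ Y ] e)
⋆-⋆-∪ W Y g f e i rewrite lookup-zipWith _∨_ i W Y with lookup W i | lookup Y i
... | true  | _     = refl
... | false | true  = refl
... | false | false = refl

⋆-∪ : ∀ (W Y : Subset n) g f → g ⋆[ W ∪ Y ] f ≗ (g ⋆[ W ] f) ⋆[ Y ] f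
⋆-∪ W Y g f i rewrite lookup-zipWith _∨_ i W Y with lookup W i | lookup Y i
... | true  | true  = refl
... | true  | false = refl
... | false | _     = refl

⋆-comm : ∀ {Y Z : Subset n} → Empty (Y ∩ Z) → ∀ g f e → (g ⋆[ Y ] f) ⋆[ Z ] e ≗ (g ⋆[ Z ] e) ⋆[ Y ] f
⋆-comm {Y = Y} {Z} Y∩Z=∅ g f e i with lookup Y i in eY | lookup Z i in eZ
... | true  | true  = contradiction (i , x∈p∩q⁺ (lookup⇒[]= i Y eY , lookup⇒[]= i Z eZ)) Y∩Z=∅
... | true  | false = refl
... | false | _     = refl

⋆-∁ : ∀ (P : Subset n) g f → g ⋆[ ∁ P ] f ≗ f ⋆[ P ] g
⋆-∁ P g f i rewrite lookup-map i not P with lookup P i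
... | true  = refl
... | false = refl

⋆-⁅⁆-agree : ∀ (x : Fin n) w g → w x ≡ g x → w ⋆[ ⁅ x ⁆ ] g ≗ w
⋆-⁅⁆-agree x w g wx≡gx i with i ≟ x
... | yes refl = ≡.trans (⋆-∈ w g (x∈⁅x⁆ x)) (≡.sym wx≡gx)
... | no  i≢x  = ⋆-∉ w g (x≢y⇒x∉⁅y⁆ i≢x)

⋆-cong-on : ∀ {D Y : Subset n} {g h : Assignment n} → (∀ i → i ∈ D ─ Y → g i ≡ h i) →
            ∀ f i → i ∈ D → (g ⋆[ Y ] f) i ≡ (h ⋆[ Y ] f) i
⋆-cong-on {Y = Y} {g} {h} g≡h f i i∈D with i ∈? Y
... | yes i∈Y = ≡.trans (⋆-∈ g f i∈Y) (≡.sym (⋆-∈ h f i∈Y))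
... | no  i∉Y = begin
  (g ⋆[ Y ] f) i  ≡⟨ ⋆-∉ g f i∉Y ⟩
  g i             ≡⟨ g≡h i (x∈p∧x∉q⇒x∈p─q i∈D i∉Y) ⟩
  h i             ≡⟨ ⋆-∉ h f i∉Y ⟨
  (h ⋆[ Y ] f) i  ∎
  where open ≡.≡-Reasoning

mem-resp : ∀ {𝒮 : System n} {g h} → WellFormed 𝒮 → g ≗ h → mem 𝒮 g → mem 𝒮 h
mem-resp wf g≗h = wf _ _ (λ i _ → g≗h i)

StronglyShatters⇒Shatters : ∀ {𝒮 : System n} {Y} → StronglyShatters 𝒮 Y → Shatters 𝒮 Y
StronglyShatters⇒Shatters (g , all) f = g , all f

≈S-refl : ∀ {𝒮 : System n} → 𝒮 ≈S 𝒮
≈S-refl = refl , λ _ → ⇔.refl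

≈S-trans : ∀ {𝒮 𝒯 𝒰 : System n} → 𝒮 ≈S 𝒯 → 𝒯 ≈S 𝒰 → 𝒮 ≈S 𝒰
≈S-trans (d₁ , m₁) (d₂ , m₂) = ≡.trans d₁ d₂ , λ g → ⇔.trans (m₁ g) (m₂ g)

SE-resp : ∀ {𝒮 𝒯 : System n} → 𝒮 ≈S 𝒯 → SE 𝒮 → SE 𝒯
SE-resp {𝒮 = 𝒮} {𝒯} (refl , m) se Y Y⊆ = mk⇔
  (λ sh → map₂ (to ∘_) (Equivalence.to (se Y Y⊆) (map₂ from ∘ sh)))
  (StronglyShatters⇒Shatters {𝒮 = 𝒯} {Y})
  where
    to : ∀ {g} → mem 𝒮 g → mem 𝒯 g
    to = Equivalence.to (m _)
    from : ∀ {g} → mem 𝒯 g → mem 𝒮 g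
    from = Equivalence.from (m _)

support : BoolOp n → Subset n
support (Int Y) = Y
support (Un Y)  = Y

mem-apply : BoolOp n → System n → Assignment n → Set
mem-apply (Int Y) 𝒮 g = ∀ f → mem 𝒮 (g ⋆[ Y ] f)
mem-apply (Un Y)  𝒮 g = ∃ λ f → mem 𝒮 (g ⋆[ Y ] f)

apply : BoolOp n → System n → System n
apply o 𝒮 = mkSystem (dim 𝒮 ─ support o) (mem-apply o 𝒮)

applyOp-defined : ∀ o (𝒮 : System n) → support o ⊆ dim 𝒮 → applyOp o 𝒮 ≡ just (apply o 𝒮)
applyOp-defined (Int Y) 𝒮 Y⊆ with Y ⊆? dim 𝒮
... | yes _   = refl
... | no  Y⊈ = ⊥-elim (Y⊈ Y⊆)
applyOp-defined (Un Y) 𝒮 Y⊆ with Y ⊆? dim 𝒮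
... | yes _   = refl
... | no  Y⊈ = ⊥-elim (Y⊈ Y⊆)

applyOp-undefined : ∀ o (𝒮 : System n) → ¬ support o ⊆ dim 𝒮 → applyOp o 𝒮 ≡ nothing
applyOp-undefined (Int Y) 𝒮 Y⊈ with Y ⊆? dim 𝒮
... | yes Y⊆ = ⊥-elim (Y⊈ Y⊆)
... | no  _   = refl
applyOp-undefined (Un Y) 𝒮 Y⊈ with Y ⊆? dim 𝒮
... | yes Y⊆ = ⊥-elim (Y⊈ Y⊆)
... | no  _   = refl

apply-cong : ∀ o {𝒮 𝒯 : System n} → 𝒮 ≈S 𝒯 → apply o 𝒮 ≈S apply o 𝒯
apply-cong (Int Y) (refl , m) = refl , λ g → mk⇔ (λ all f → Equivalence.to (m _) (all f))
                                                  (λ all f → Equivalence.from (m _) (all f))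
apply-cong (Un Y)  (refl , m) = refl , λ g → mk⇔ (map₂ (Equivalence.to (m _)))
                                                  (map₂ (Equivalence.from (m _)))

WellFormed-apply : ∀ o {𝒮 : System n} → WellFormed 𝒮 → WellFormed (apply o 𝒮)
WellFormed-apply (Int Y) wf g h g≡h all f = wf _ _ (⋆-cong-on g≡h f) (all f)
WellFormed-apply (Un Y)  wf g h g≡h (f , m) = f , wf _ _ (⋆-cong-on g≡h f) m

SE-apply : ∀ o {𝒮 : System n} → WellFormed 𝒮 → SE 𝒮 → support o ⊆ dim 𝒮 → SE (apply o 𝒮)
SE-apply (Int Y) {𝒮} wf se Y⊆ W W⊆ = mk⇔ strongly (StronglyShatters⇒Shatters {𝒮 = apply (Int Y) 𝒮} {W})
  where
    W∪Y⊆ : W ∪ Y ⊆ dim 𝒮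
    W∪Y⊆ i∈ with x∈p∪q⁻ W Y i∈
    ... | inj₁ i∈W = p─q⊆p (dim 𝒮) Y (W⊆ i∈W)
    ... | inj₂ i∈Y = Y⊆ i∈Y
    shatters-W∪Y : Shatters (apply (Int Y) 𝒮) W → Shatters 𝒮 (W ∪ Y)
    shatters-W∪Y sh f = let g , all = sh f in
      g , mem-resp wf (≡.sym ∘ ⋆-∪ W Y g f) (all f)
    strongly : Shatters (apply (Int Y) 𝒮) W → StronglyShatters (apply (Int Y) 𝒮) W
    strongly sh = let u , all = Equivalence.to (se (W ∪ Y) W∪Y⊆) (shatters-W∪Y sh) in
      u , λ f f′ → mem-resp wf (≡.sym ∘ ⋆-⋆-∪ W Y u f f′) (all (f ⋆[ Y ] f′))
SE-apply (Un Y) {𝒮} wf se Y⊆ W W⊆ = mk⇔ strongly (StronglyShatters⇒Shatters {𝒮 = apply (Un Y) 𝒮} {W})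
  where
    W⊆dim : W ⊆ dim 𝒮
    W⊆dim = p─q⊆p (dim 𝒮) Y ∘ W⊆
    W∩Y=∅ : Empty (W ∩ Y)
    W∩Y=∅ = subst Empty (∩-comm Y W) (⊆─⇒disjoint W⊆)
    shatters-W : Shatters (apply (Un Y) 𝒮) W → Shatters 𝒮 W
    shatters-W sh f = let g , f′ , m = sh f in g ⋆[ Y ] f′ , mem-resp wf (⋆-comm W∩Y=∅ g f f′) m
    strongly : Shatters (apply (Un Y) 𝒮) W → StronglyShatters (apply (Un Y) 𝒮) W
    strongly sh = let u , all = Equivalence.to (se W W⊆dim) (shatters-W sh) in
      u , λ f → u ⋆[ W ] f , mem-resp wf (≡.sym ∘ ⋆-idem Y (u ⋆[ W ] f)) (all f)

pin : Subset n → Assignment n → System n → System n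
pin F g 𝒮 = mkSystem (dim 𝒮 ─ F) (λ v → mem 𝒮 (v ⋆[ F ] g))

WellFormed-pin : ∀ F g {𝒮 : System n} → WellFormed 𝒮 → WellFormed (pin F g 𝒮)
WellFormed-pin F g wf v w v≡w = wf _ _ (⋆-cong-on v≡w g)

pin-⊥ : ∀ g {𝒮 : System n} → WellFormed 𝒮 → 𝒮 ≈S pin ⊥ g 𝒮
pin-⊥ g {𝒮} wf = ≡.sym (p─⊥≡p (dim 𝒮)) , λ v →
  mk⇔ (mem-resp wf (λ i → ≡.sym (⋆-∉ v g ∉⊥))) (mem-resp wf (λ i → ⋆-∉ v g ∉⊥))

pin-pin : ∀ A B g {𝒮 : System n} → WellFormed 𝒮 → pin A g (pin B g 𝒮) ≈S pin (A ∪ B) g 𝒮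
pin-pin A B g {𝒮} wf = dim≡ , λ v → mk⇔ (mem-resp wf (≡.sym ∘ ⋆-∪ A B v g)) (mem-resp wf (⋆-∪ A B v g))
  where
    dim≡ : dim 𝒮 ─ B ─ A ≡ dim 𝒮 ─ (A ∪ B)
    dim≡ = ≡.trans (p─q─r≡p─r─q (dim 𝒮) B A) (p─q─r≡p─q∪r (dim 𝒮) A B)

module _ (x : Fin n) (g : Assignment n) {𝒯 : System n} (wf : WellFormed 𝒯) {Y : Subset n} (x∉Y : x ∉ Y)
         (sh : Shatters (pin ⁅ x ⁆ g 𝒯) Y) where

  Shatters-pin-⁅⁆ : Shatters 𝒯 Y
  Shatters-pin-⁅⁆ f = let u , m = sh f in u ⋆[ ⁅ x ⁆ ] g , mem-resp wf (⋆-comm Y∩⁅x⁆=∅ u f g) m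
    where
      Y∩⁅x⁆=∅ : Empty (Y ∩ ⁅ x ⁆)
      Y∩⁅x⁆=∅ (i , i∈Y∩⁅x⁆) = let i∈Y , i∈⁅x⁆ = x∈p∩q⁻ Y ⁅ x ⁆ i∈Y∩⁅x⁆ in
        x∉Y (subst (_∈ Y) (x∈⁅y⁆⇒x≡y x i∈⁅x⁆) i∈Y)

  -- f ↦ (if f x ≡ g x then the witness given by sh else u₀).
  Shatters-pin-⁅⁆-∪ : ∀ {u₀} → u₀ x ≢ g x → (∀ f → mem 𝒯 (u₀ ⋆[ Y ] f)) →
                      Shatters 𝒯 (Y ∪ ⁅ x ⁆)
  Shatters-pin-⁅⁆-∪ {u₀} u₀x≢gx all₀ f with f x ≟B g x
  ... | yes fx≡gx = let u , m = sh f in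
    u , mem-resp wf (λ i → ≡.trans (⋆-⋆-∪ Y ⁅ x ⁆ u f g i)
                                   (⋆-congʳ (Y ∪ ⁅ x ⁆) u (⋆-⁅⁆-agree x f g fx≡gx) i)) m
  ... | no  fx≢gx = u₀ , mem-resp wf (λ i → ≡.trans (≡.sym (⋆-⁅⁆-agree x (u₀ ⋆[ Y ] f) f u₀⋆f-at-x i))
                                                     (≡.sym (⋆-∪ Y ⁅ x ⁆ u₀ f i))) (all₀ f)
    where
      u₀⋆f-at-x : (u₀ ⋆[ Y ] f) x ≡ f x
      u₀⋆f-at-x = ≡.trans (⋆-∉ u₀ f x∉Y) (≡.trans (¬-not u₀x≢gx) (≡.sym (¬-not fx≢gx)))

-- A strong witness u₀ for Y in 𝒯 serves for the restriction unless u₀ x ≢ g x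
-- and x ∈ dim 𝒯; then strong shattering of Y ∪ ⁅ x ⁆ provides one.
SE-pin-⁅⁆ : ∀ x g {𝒯 : System n} → WellFormed 𝒯 → SE 𝒯 → SE (pin ⁅ x ⁆ g 𝒯)
SE-pin-⁅⁆ x g {𝒯} wf se Y Y⊆ = mk⇔ strongly (StronglyShatters⇒Shatters {𝒮 = pin ⁅ x ⁆ g 𝒯} {Y})
  where
    Y⊆dim : Y ⊆ dim 𝒯
    Y⊆dim = p─q⊆p (dim 𝒯) ⁅ x ⁆ ∘ Y⊆
    x∉Y : x ∉ Y
    x∉Y x∈Y = x∈p─q⇒x∉q (dim 𝒯) ⁅ x ⁆ (Y⊆ x∈Y) (x∈⁅x⁆ x)
    Y∪⁅x⁆⊆dim : x ∈ dim 𝒯 → Y ∪ ⁅ x ⁆ ⊆ dim 𝒯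
    Y∪⁅x⁆⊆dim x∈dim i∈ with x∈p∪q⁻ Y ⁅ x ⁆ i∈
    ... | inj₁ i∈Y   = Y⊆dim i∈Y
    ... | inj₂ i∈⁅x⁆ rewrite x∈⁅y⁆⇒x≡y x i∈⁅x⁆ = x∈dim
    strongly : Shatters (pin ⁅ x ⁆ g 𝒯) Y → StronglyShatters (pin ⁅ x ⁆ g 𝒯) Y
    strongly sh with Equivalence.to (se Y Y⊆dim) (Shatters-pin-⁅⁆ x g wf x∉Y sh)
    ... | u₀ , all₀ with u₀ x ≟B g x | x ∈? dim 𝒯
    ... | yes u₀x≡gx | _ =
      u₀ , λ f → mem-resp wf (≡.sym ∘ ⋆-⁅⁆-agree x (u₀ ⋆[ Y ] f) g (≡.trans (⋆-∉ u₀ f x∉Y) u₀x≡gx))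
                             (all₀ f)
    ... | no _ | no x∉dim =
      u₀ , λ f → wf _ _ (λ i i∈dim → ≡.sym (⋆-∉ (u₀ ⋆[ Y ] f) g (i∉⁅x⁆ i∈dim))) (all₀ f)
      where
        i∉⁅x⁆ : ∀ {i} → i ∈ dim 𝒯 → i ∉ ⁅ x ⁆
        i∉⁅x⁆ i∈dim i∈⁅x⁆ rewrite x∈⁅y⁆⇒x≡y x i∈⁅x⁆ = x∉dim i∈dim
    ... | no u₀x≢gx | yes x∈dim =
      let u₁ , all₁ = Equivalence.to (se (Y ∪ ⁅ x ⁆) (Y∪⁅x⁆⊆dim x∈dim))
                                     (Shatters-pin-⁅⁆-∪ x g wf x∉Y sh u₀x≢gx all₀) in
      u₁ , λ f → mem-resp wf (≡.sym ∘ ⋆-⋆-∪ Y ⁅ x ⁆ u₁ f g) (all₁ (f ⋆[ ⁅ x ⁆ ] g))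

SE-pin : ∀ F g {𝒮 : System n} → WellFormed 𝒮 → SE 𝒮 → SE (pin F g 𝒮)
SE-pin F g {𝒮} wf se = go F (⊂-wellFounded F)
  where
    go : ∀ F → Acc _⊂_ F → SE (pin F g 𝒮)
    go F (acc rec) with nonempty? F
    ... | no F=∅ rewrite Empty-unique F=∅ = SE-resp (pin-⊥ g wf) se
    ... | yes (x , x∈F) = subst (λ F → SE (pin F g 𝒮)) (⁅x⁆∪p-x≡p x∈F)
      (SE-resp (pin-pin ⁅ x ⁆ (F - x) g wf)
        (SE-pin-⁅⁆ x g (WellFormed-pin (F - x) g wf) (go (F - x) (rec (x∈p⇒p-x⊂p x∈F)))))

∀∃⇒∃∀ : ∀ {𝒮 : System n} {Y Z} → WellFormed 𝒮 → SE 𝒮 → Y ⊆ dim 𝒮 → Empty (Y ∩ Z) → ∀ g →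
        (∀ f → ∃ λ e → mem 𝒮 ((g ⋆[ Y ] f) ⋆[ Z ] e)) → ∃ λ e → ∀ f → mem 𝒮 ((g ⋆[ Z ] e) ⋆[ Y ] f)
∀∃⇒∃∀ {𝒮 = 𝒮} {Y} {Z} wf se Y⊆ Y∩Z=∅ g ∀∃ =
  map₂ (λ all f → mem-resp wf (unpin _ f) (all f)) (Equivalence.to (SE-pin F g wf se Y Y⊆dim-R) shatters-Y)
  where
    F = ∁ (Z ∪ Y)
    unpin : ∀ e f → (e ⋆[ Y ] f) ⋆[ F ] g ≗ (g ⋆[ Z ] e) ⋆[ Y ] f
    unpin e f i = ≡.trans (⋆-∁ (Z ∪ Y) (e ⋆[ Y ] f) g i) (≡.sym (⋆-⋆-∪ Z Y g e f i))
    Y⊆dim-R : Y ⊆ dim 𝒮 ─ F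
    Y⊆dim-R i∈Y = x∈p∧x∉q⇒x∈p─q (Y⊆ i∈Y) (x∈p⇒x∉∁p (x∈p∪q⁺ (inj₂ i∈Y)))
    shatters-Y : Shatters (pin F g 𝒮) Y
    shatters-Y f = let e , m = ∀∃ f in
      e , mem-resp wf (λ i → ≡.trans (⋆-comm Y∩Z=∅ g f e i) (≡.sym (unpin e f i))) m

mem-⋆-comm : ∀ {𝒮 : System n} {Y Z} → WellFormed 𝒮 → Empty (Y ∩ Z) →
             ∀ g f e → mem 𝒮 ((g ⋆[ Y ] f) ⋆[ Z ] e) ⇔ mem 𝒮 ((g ⋆[ Z ] e) ⋆[ Y ] f)
mem-⋆-comm wf Y∩Z=∅ g f e = mk⇔ (mem-resp wf (⋆-comm Y∩Z=∅ g f e)) (mem-resp wf (≡.sym ∘ ⋆-comm Y∩Z=∅ g f e))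

mem-apply-comm : ∀ o o′ {𝒮 : System n} → WellFormed 𝒮 → SE 𝒮 →
                 support o ⊆ dim 𝒮 → support o′ ⊆ dim 𝒮 → Empty (support o ∩ support o′) →
                 ∀ g → mem-apply o′ (apply o 𝒮) g ⇔ mem-apply o (apply o′ 𝒮) g
mem-apply-comm (Int Y) (Int Z) wf _ _ _ Y∩Z=∅ g = mk⇔
  (λ all f e → Equivalence.from (mem-⋆-comm wf Y∩Z=∅ g f e) (all e f))
  (λ all e f → Equivalence.to (mem-⋆-comm wf Y∩Z=∅ g f e) (all f e))
mem-apply-comm (Un Y) (Un Z) wf _ _ _ Y∩Z=∅ g = mk⇔
  (λ (e , f , m) → f , e , Equivalence.from (mem-⋆-comm wf Y∩Z=∅ g f e) m)
  (λ (f , e , m) → e , f , Equivalence.to (mem-⋆-comm wf Y∩Z=∅ g f e) m)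
mem-apply-comm (Int Y) (Un Z) wf se Y⊆ _ Y∩Z=∅ g = mk⇔
  (λ (e , all) f → e , Equivalence.from (mem-⋆-comm wf Y∩Z=∅ g f e) (all f))
  (∀∃⇒∃∀ wf se Y⊆ Y∩Z=∅ g)
mem-apply-comm (Un Y) (Int Z) wf se _ Z⊆ Y∩Z=∅ g = mk⇔
  (∀∃⇒∃∀ wf se Z⊆ (subst Empty (∩-comm Y Z) Y∩Z=∅) g)
  (λ (f , all) e → f , Equivalence.to (mem-⋆-comm wf Y∩Z=∅ g f e) (all e))

Composable : BoolOp n → BoolOp n → System n → Set
Composable o o′ 𝒮 = support o ⊆ dim 𝒮 × support o′ ⊆ dim 𝒮 ─ support o

composable? : ∀ o o′ (𝒮 : System n) → Dec (Composable o o′ 𝒮)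
composable? o o′ 𝒮 = (support o ⊆? dim 𝒮) ×-dec (support o′ ⊆? dim 𝒮 ─ support o)

Composable-swap : ∀ o o′ (𝒮 : System n) → Composable o o′ 𝒮 → Composable o′ o 𝒮
Composable-swap o o′ 𝒮 (o⊆ , o′⊆) =
  p─q⊆p (dim 𝒮) (support o) ∘ o′⊆ ,
  λ i∈o → x∈p∧x∉q⇒x∈p─q (o⊆ i∈o) (λ i∈o′ → x∈p─q⇒x∉q (dim 𝒮) (support o) (o′⊆ i∈o′) i∈o)

apply-comm : ∀ o o′ {𝒮 : System n} → WellFormed 𝒮 → SE 𝒮 → Composable o o′ 𝒮 →
             apply o′ (apply o 𝒮) ≈S apply o (apply o′ 𝒮)
apply-comm o o′ {𝒮} wf se (o⊆ , o′⊆) =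
  p─q─r≡p─r─q (dim 𝒮) (support o) (support o′) ,
  mem-apply-comm o o′ wf se o⊆ (p─q⊆p (dim 𝒮) (support o) ∘ o′⊆) (⊆─⇒disjoint o′⊆)

≈M-refl : ∀ (m : Maybe (System n)) → m ≈M m
≈M-refl nothing  = tt
≈M-refl (just _) = ≈S-refl , tt

≈M-trans : ∀ (a b c : Maybe (System n)) → a ≈M b → b ≈M c → a ≈M c
≈M-trans nothing  nothing  nothing  _       _       = tt
≈M-trans (just _) (just _) (just _) (p , _) (q , _) = ≈S-trans p q , tt

applySeq-cong : ∀ Q {𝒮 𝒯 : System n} → 𝒮 ≈S 𝒯 → applySeq Q 𝒮 ≈M applySeq Q 𝒯
applySeq-cong []      𝒮≈𝒯 = 𝒮≈𝒯 , tt
applySeq-cong (o ∷ Q) {𝒮} {𝒯} 𝒮≈𝒯@(refl , _) with support o ⊆? dim 𝒮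
... | yes o⊆ rewrite applyOp-defined o 𝒮 o⊆ | applyOp-defined o 𝒯 o⊆ = applySeq-cong Q (apply-cong o 𝒮≈𝒯)
... | no  o⊈ rewrite applyOp-undefined o 𝒮 o⊈ | applyOp-undefined o 𝒯 o⊈ = tt

applySeq-prep : ∀ o {Q Q′} {𝒮 : System n} → WellFormed 𝒮 → SE 𝒮 →
                (∀ {𝒯} → WellFormed 𝒯 → SE 𝒯 → applySeq Q 𝒯 ≈M applySeq Q′ 𝒯) →
                applySeq (o ∷ Q) 𝒮 ≈M applySeq (o ∷ Q′) 𝒮
applySeq-prep o {𝒮 = 𝒮} wf se Q≈Q′ with support o ⊆? dim 𝒮
... | yes o⊆ rewrite applyOp-defined o 𝒮 o⊆ = Q≈Q′ (WellFormed-apply o wf) (SE-apply o wf se o⊆)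
... | no  o⊈ rewrite applyOp-undefined o 𝒮 o⊈ = tt

applySeq-composable : ∀ o o′ Q {𝒮 : System n} → Composable o o′ 𝒮 →
                      applySeq (o ∷ o′ ∷ Q) 𝒮 ≡ applySeq Q (apply o′ (apply o 𝒮))
applySeq-composable o o′ Q {𝒮} (o⊆ , o′⊆)
  rewrite applyOp-defined o 𝒮 o⊆ | applyOp-defined o′ (apply o 𝒮) o′⊆ = refl

applySeq-not-composable : ∀ o o′ Q {𝒮 : System n} → ¬ Composable o o′ 𝒮 →
                          applySeq (o ∷ o′ ∷ Q) 𝒮 ≡ nothing
applySeq-not-composable o o′ Q {𝒮} ¬c with support o ⊆? dim 𝒮
... | no  o⊈ rewrite applyOp-undefined o 𝒮 o⊈ = refl
... | yes o⊆ rewrite applyOp-defined o 𝒮 o⊆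
                   | applyOp-undefined o′ (apply o 𝒮) (λ o′⊆ → ¬c (o⊆ , o′⊆)) = refl

applySeq-swap : ∀ o o′ Q {𝒮 : System n} → WellFormed 𝒮 → SE 𝒮 →
                applySeq (o ∷ o′ ∷ Q) 𝒮 ≈M applySeq (o′ ∷ o ∷ Q) 𝒮
applySeq-swap o o′ Q {𝒮} wf se with composable? o o′ 𝒮
... | yes c  = subst₂ _≈M_
  (≡.sym (applySeq-composable o o′ Q c))
  (≡.sym (applySeq-composable o′ o Q (Composable-swap o o′ 𝒮 c)))
  (applySeq-cong Q (apply-comm o o′ wf se c))
... | no  ¬c = subst₂ _≈M_
  (≡.sym (applySeq-not-composable o o′ Q ¬c))
  (≡.sym (applySeq-not-composable o′ o Q (¬c ∘ Composable-swap o′ o 𝒮)))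
  tt

applySeq-↭ : ∀ {Q Q′ : List (BoolOp n)} {𝒮} → WellFormed 𝒮 → SE 𝒮 → Q′ ↭ Q →
             applySeq Q′ 𝒮 ≈M applySeq Q 𝒮
applySeq-↭ wf se refl                         = ≈M-refl _
applySeq-↭ wf se (prep {xs = xs} {ys} o p)    = applySeq-prep o {xs} {ys} wf se λ wf′ se′ → applySeq-↭ wf′ se′ p
applySeq-↭ wf se (swap {xs = xs} {ys} o o′ p) = ≈M-trans _ _ _ (applySeq-swap o o′ xs wf se)
  (applySeq-prep o′ {o ∷ xs} {o ∷ ys} wf se λ wf′ se′ →
     applySeq-prep o {xs} {ys} wf′ se′ λ wf″ se″ → applySeq-↭ wf″ se″ p)
applySeq-↭ wf se (trans p q)                  = ≈M-trans _ _ _ (applySeq-↭ wf se p) (applySeq-↭ wf se q)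

mainTheorem15 : ∀ {n : ℕ} (𝒮 : System n) → WellFormed 𝒮 → DecidableSystem 𝒮 → SE 𝒮 →
    (Q Q′ : List (BoolOp n)) → Q′ ↭ Q → applySeq Q′ 𝒮 ≈M applySeq Q 𝒮
mainTheorem15 𝒮 wf _ se Q Q′ = applySeq-↭ wf se
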